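{- For every integer $n\geq 2$, the friendship graph $F_n$ satisfies $$D_l(F_n)=D(F_n)=\left\lceil \frac{1+\sqrt{8n+1}}{2}\right\rceil .$$
   Context: For $n\geq 2$, the friendship graph $F_n$ is obtained by joining $n$ copies of the cycle $C_3$ at a single common vertex. It has a central vertex $w$ and vertices $v_1,\dots,v_{2n}$, where $w,v_{2i-1},v_{2i}$ form the $i$-th triangle. A labeling $\phi:V(G)\to\{1,\dots,r\}$ of a graph $G$ is distinguishing if the only automorphism $\sigma$ of $G$ with $\phi(\sigma(x))=\phi(x)$ for all $x\in V(G)$ is the identity. The distinguishing number $D(G)$ is the least $r$ such that $G$ has a distinguishing labeling with $r$ labels. A list assignment $L=\{L(v)\}_{v\in V(G)}$ gives each vertex a set of labels. A distinguishing $L$-labeling is a distinguishing labeling in which each vertex $v$ receives a label from $L(v)$. The list distinguishing number $D_l(G)$ is the least $k$ such that every list assignment with $|L(v)|=k$ for all $v$ admits a distinguishing $L$-labeling. -}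

module Defs where

open import Data.Nat using (ℕ; zero; suc; _+_; _*_; _∸_; _^_; _≤_)
open import Data.Nat.DivMod using (_/_)
open import Data.Fin using (Fin; zero; suc; toℕ)
open import Data.Fin.Permutation using (Permutation′; _⟨$⟩ʳ_)
open import Data.Empty using (⊥)
open import Data.Unit using (⊤)
open import Data.Product using (_×_; Σ; ∃)
open import Data.List using (List; length)
open import Data.List.Membership.Propositional using (_∈_)
open import Data.List.Relation.Unary.Unique.Propositional using (Unique)
open import Relation.Binary.PropositionalEquality using (_≡_; _≢_)
open import Function.Bundles using (_⇔_)

Graph : ℕ → Set₁
Graph N = Fin N → Fin N → Set

-- Friendship graph F_n on Fin (1 + 2n): vertex zero is the centre w,
-- vertex (suc i) (i : Fin (2n), 0-based) is v_{i+1}.  v_{2i-1}, v_{2i}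
-- (1-based) are 0-based 2i-2, 2i-1, i.e. the same quotient by 2.
Friendship : (n : ℕ) → Graph (suc (2 * n))
Friendship n zero    zero    = ⊥
Friendship n zero    (suc _) = ⊤
Friendship n (suc _) zero    = ⊤
Friendship n (suc a) (suc b) = (a ≢ b) × (toℕ a / 2 ≡ toℕ b / 2)

IsAutomorphism : ∀ {N} → Graph N → Permutation′ N → Set
IsAutomorphism {N} G σ = ∀ (x y : Fin N) → G x y ⇔ G (σ ⟨$⟩ʳ x) (σ ⟨$⟩ʳ y)

IsDistinguishing : ∀ {N} {A : Set} → Graph N → (Fin N → A) → Set
IsDistinguishing {N} G φ =
  ∀ (σ : Permutation′ N) → IsAutomorphism G σ →
    (∀ x → φ (σ ⟨$⟩ʳ x) ≡ φ x) → ∀ x → σ ⟨$⟩ʳ x ≡ x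

-- G has a distinguishing labeling with r labels {1..r} (modelled as Fin r).
Distinguishable : ∀ {N} → Graph N → ℕ → Set
Distinguishable {N} G r = Σ (Fin N → Fin r) λ φ → IsDistinguishing G φ

ListDistinguishable : ∀ {N} → Graph N → ℕ → Set
ListDistinguishable {N} G k =
  ∀ (L : Fin N → List ℕ) → (∀ v → Unique (L v)) → (∀ v → length (L v) ≡ k) →
    Σ (Fin N → ℕ) λ φ → (∀ v → φ v ∈ L v) × IsDistinguishing G φ

IsLeast : (ℕ → Set) → ℕ → Set
IsLeast P m = P m × (∀ k → P k → m ≤ k)

-- c = ⌈(1 + √(8n+1))/2⌉ : c is the least natural number with
-- (1 + √(8n+1))/2 ≤ c, i.e. 1 ≤ c and √(8n+1) ≤ 2c - 1, i.e. 8n+1 ≤ (2c-1)^2.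
CeilCond : ℕ → ℕ → Set
CeilCond n c = (1 ≤ c) × (8 * n + 1 ≤ (2 * c ∸ 1) ^ 2)

IsCeilFormula : ℕ → ℕ → Set
IsCeilFormula n c = IsLeast (CeilCond n) c

DistNumberIs : ∀ {N} → Graph N → ℕ → Set
DistNumberIs G d = IsLeast (Distinguishable G) d

ListDistNumberIs : ∀ {N} → Graph N → ℕ → Set
ListDistNumberIs G d = IsLeast (ListDistinguishable G) d

module Submission where

open import Defs
open import Data.Nat using (ℕ; zero; suc; _+_; _*_; _∸_; _^_; _≤_; _<_; z≤n; s≤s; s≤s⁻¹; _≟_)
open import Data.Nat.Properties
  using ( ≤-refl; ≤-reflexive; ≤-trans; <-≤-trans; <⇒≤; <⇒≢; <-cmp; m≤m+n; m∸n≤m; m<1+n⇒m<n∨m≡n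
        ; +-comm; +-suc; *-comm; *-assoc; *-suc; *-identityʳ; *-distribˡ-+; *-distribʳ-+
        ; +-mono-≤; +-monoˡ-≤; +-monoʳ-≤; +-monoˡ-<; +-monoʳ-<; *-monoˡ-≤; *-monoʳ-≤
        ; +-cancelˡ-≡; +-cancelʳ-≤; +-cancelʳ-<; *-cancelˡ-≤; module ≤-Reasoning )
open import Data.Nat.DivMod
  using ( _/_; _%_; m≡m%n+[m/n]*n; m%n<n; [m+kn]%n≡m%n; m<n⇒m%n≡m; +-distrib-/-∣ʳ; m<n⇒m/n≡0
        ; m*n/n≡m; m<n*o⇒m/o<n )
open import Data.Nat.Divisibility using (n∣m*n)
open import Data.Nat.Tactic.RingSolver using (solve-∀)
open import Data.Fin using (Fin; zero; suc; toℕ; fromℕ<)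
import Data.Fin as Fin
open import Data.Fin.Properties
  using (toℕ-injective; toℕ<n; toℕ-fromℕ<; fromℕ<-injective; suc-injective; 0≢1+n; injective⇒≤)
open import Data.Fin.Permutation using (Permutation′; _⟨$⟩ʳ_; _⟨$⟩ˡ_; inverseˡ; transpose; _∘ₚ_; lift₀)
open import Data.List using (List; []; _∷_; length; filter; lookup; map; upTo)
open import Data.List.Properties using (filter-all; filter-accept; filter-reject; length-map; length-upTo)
open import Data.List.Relation.Unary.All as All using (All)
open import Data.List.Relation.Unary.Any using (Any; here; there; any?; index)
open import Data.List.Relation.Unary.Any.Properties using (lookup-index)
open import Data.List.Relation.Unary.AllPairs using (_∷_)
open import Data.List.Relation.Unary.Unique.Propositional using (Unique)
open import Data.List.Relation.Unary.Unique.Propositional.Properties using (filter⁺; upTo⁺)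
open import Data.List.Membership.Propositional using (_∈_; find; lose)
open import Data.List.Membership.Propositional.Properties
  using (∈-lookup; ∈-filter⁺; ∈-filter⁻; ∈-map⁺; ∈-upTo⁺; ∈-upTo⁻)
open import Data.Empty using (⊥; ⊥-elim)
open import Data.Unit using (tt)
open import Data.Product using (_×_; Σ; ∃; ∃₂; _,_; proj₁; proj₂; swap)
open import Data.Sum using (_⊎_; inj₁; inj₂; [_,_]′)
open import Function using (id; _∘_)
open import Function.Bundles using (Equivalence; mk⇔)
open import Relation.Binary.Definitions using (tri<; tri≈; tri>)
open import Relation.Binary.PropositionalEquality
open import Relation.Nullary using (¬_; Dec; yes; no; ¬?)
open import Relation.Nullary.Decidable using (_×-dec_; _⊎-dec_; decidable-stable)
open import Relation.Unary using (Decidable)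

-- Write pairs r = r(r - 1)/2 for the number of 2-subsets of an r-set.  The
-- leaves of F_n are the vertices suc a, a : Fin (2n); such a leaf has a side
-- (toℕ a mod 2) and a triangle (toℕ a div 2), and two leaves are adjacent iff
-- they are mates: distinct leaves of one triangle.
--  * As n ≥ 2, only the centre has three neighbours, so automorphisms fix it;
--    hence a labeling is distinguishing as soon as the labels on a leaf and
--    its mate determine the leaf (distinguishing-criterion).
--  * Conversely, swapping two mates, or exchanging two triangles, extends to
--    an automorphism; so a distinguishing labeling gives the two leaves of a
--    triangle different labels and different triangles different unordered
--    label pairs.  Ranking these pairs injects the triangles into the
--    2-subsets of the labels: D(F_n) = r forces n ≤ pairs r.
--  * Conversely, if n ≤ pairs c then for lists of c labels a greedy choice
--    (fresh-pair, a counting argument) gives the triangles pairwise different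
--    pairs of distinct labels from their leaves' lists, so D_l(F_n) ≤ c.
--  * Finally D ≤ D_l, and the ceiling formula for c is equivalent to n ≤ pairs c.

side : ∀ {m} → Fin m → ℕ
side a = toℕ a % 2

triangle : ∀ {m} → Fin m → ℕ
triangle a = toℕ a / 2

side<2 : ∀ {m} (a : Fin m) → side a < 2
side<2 a = m%n<n (toℕ a) 2

triangle<n : ∀ {n} (a : Fin (2 * n)) → triangle a < n
triangle<n {n} a = m<n*o⇒m/o<n (subst (toℕ a <_) (*-comm 2 n) (toℕ<n a))

leaf-determined : ∀ {m} {a b : Fin m} → side a ≡ side b → triangle a ≡ triangle b → a ≡ b
leaf-determined {a = a} {b} s t = toℕ-injective (begin
  toℕ a                      ≡⟨ m≡m%n+[m/n]*n (toℕ a) 2 ⟩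
  side a + triangle a * 2    ≡⟨ cong₂ (λ x y → x + y * 2) s t ⟩
  side b + triangle b * 2    ≡⟨ sym (m≡m%n+[m/n]*n (toℕ b) 2) ⟩
  toℕ b                      ∎)
  where open ≡-Reasoning

leaf-at : ∀ {n s t} → s < 2 → t < n → Σ (Fin (2 * n)) λ a → side a ≡ s × triangle a ≡ t
leaf-at {n} {s} {t} s<2 t<n = fromℕ< bound , side≡ , triangle≡
  where
  bound : s + t * 2 < 2 * n
  bound = <-≤-trans (+-monoˡ-< (t * 2) s<2) (subst (suc t * 2 ≤_) (*-comm n 2) (*-monoˡ-≤ 2 t<n))
  side≡ : side (fromℕ< bound) ≡ s
  side≡ = begin
    toℕ (fromℕ< bound) % 2  ≡⟨ cong (_% 2) (toℕ-fromℕ< bound) ⟩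
    (s + t * 2) % 2         ≡⟨ [m+kn]%n≡m%n s t 2 ⟩
    s % 2                   ≡⟨ m<n⇒m%n≡m s<2 ⟩
    s                       ∎
    where open ≡-Reasoning
  triangle≡ : triangle (fromℕ< bound) ≡ t
  triangle≡ = begin
    toℕ (fromℕ< bound) / 2  ≡⟨ cong (_/ 2) (toℕ-fromℕ< bound) ⟩
    (s + t * 2) / 2         ≡⟨ +-distrib-/-∣ʳ s (n∣m*n t) ⟩
    s / 2 + t * 2 / 2       ≡⟨ cong₂ _+_ (m<n⇒m/n≡0 s<2) (m*n/n≡m t 2) ⟩
    t                       ∎
    where open ≡-Reasoning

Mates : ∀ {m} → Fin m → Fin m → Set
Mates a b = (a ≢ b) × (triangle a ≡ triangle b)

mates-sym : ∀ {m} {a b : Fin m} → Mates a b → Mates b a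
mates-sym (a≢b , t) = (λ e → a≢b (sym e)) , sym t

mates-sides-differ : ∀ {m} {a b : Fin m} → Mates a b → side a ≢ side b
mates-sides-differ (a≢b , t) s = a≢b (leaf-determined s t)

bit-complement : ∀ {s s′} → s < 2 → s′ < 2 → s ≢ s′ → s′ ≡ 1 ∸ s
bit-complement (s≤s z≤n)       (s≤s z≤n)       d = ⊥-elim (d refl)
bit-complement (s≤s z≤n)       (s≤s (s≤s z≤n)) _ = refl
bit-complement (s≤s (s≤s z≤n)) (s≤s z≤n)       _ = refl
bit-complement (s≤s (s≤s z≤n)) (s≤s (s≤s z≤n)) d = ⊥-elim (d refl)

bit-complement-differs : ∀ {s} → s < 2 → s ≢ 1 ∸ s
bit-complement-differs {0} _ ()
bit-complement-differs {1} _ ()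
bit-complement-differs {suc (suc _)} (s≤s (s≤s ()))

mate-unique : ∀ {m} {a b c : Fin m} → Mates a b → Mates a c → b ≡ c
mate-unique {a = a} {b} {c} ab ac = leaf-determined
  (trans (bit-complement (side<2 a) (side<2 b) (mates-sides-differ ab))
         (sym (bit-complement (side<2 a) (side<2 c) (mates-sides-differ ac))))
  (trans (sym (proj₂ ab)) (proj₂ ac))

mate-exists : ∀ {n} (a : Fin (2 * n)) → ∃ λ b → Mates a b
mate-exists {n} a with leaf-at (s≤s (m∸n≤m 1 (side a))) (triangle<n {n} a)
... | b , sb , tb = b , (λ { refl → bit-complement-differs (side<2 a) sb }) , sym tb

in-triangle-of-mates : ∀ {m} {u w x : Fin m} → Mates u w → triangle x ≡ triangle u → x ≢ u → x ≡ w
in-triangle-of-mates uw tx x≢u = sym (mate-unique uw ((λ e → x≢u (sym e)) , sym tx))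

first second : ∀ {n} → Fin n → Fin (2 * n)
first  i = proj₁ (leaf-at (s≤s z≤n) (toℕ<n i))
second i = proj₁ (leaf-at (s≤s (s≤s z≤n)) (toℕ<n i))

triangle-first : ∀ {n} (i : Fin n) → triangle (first i) ≡ toℕ i
triangle-first i = proj₂ (proj₂ (leaf-at (s≤s z≤n) (toℕ<n i)))

triangle-second : ∀ {n} (i : Fin n) → triangle (second i) ≡ toℕ i
triangle-second i = proj₂ (proj₂ (leaf-at (s≤s (s≤s z≤n)) (toℕ<n i)))

side-first : ∀ {n} (i : Fin n) → side (first i) ≡ 0
side-first i = proj₁ (proj₂ (leaf-at (s≤s z≤n) (toℕ<n i)))

side-second : ∀ {n} (i : Fin n) → side (second i) ≡ 1
side-second i = proj₁ (proj₂ (leaf-at (s≤s (s≤s z≤n)) (toℕ<n i)))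

first-second-mates : ∀ {n} (i : Fin n) → Mates (first i) (second i)
first-second-mates i = (λ e → 0≢1 (trans (sym (side-first i)) (trans (cong side e) (side-second i))))
                     , trans (triangle-first i) (sym (triangle-second i))
  where
  0≢1 : 0 ≢ 1
  0≢1 ()

permutation-injective : ∀ {m} (σ : Permutation′ m) {x y} → σ ⟨$⟩ʳ x ≡ σ ⟨$⟩ʳ y → x ≡ y
permutation-injective σ {x} {y} e = trans (sym (inverseˡ σ)) (trans (cong (σ ⟨$⟩ˡ_) e) (inverseˡ σ))

-- A leaf is adjacent only to the centre and to its unique mate, so a vertex
-- with three distinct neighbours is the centre.
three-neighbours⇒centre : ∀ {n} (v : Fin (suc (2 * n))) {y₁ y₂ y₃} →
  y₁ ≢ y₂ → y₁ ≢ y₃ → y₂ ≢ y₃ →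
  Friendship n v y₁ → Friendship n v y₂ → Friendship n v y₃ → v ≡ zero
three-neighbours⇒centre zero _ _ _ _ _ _ = refl
three-neighbours⇒centre (suc _) {zero}  {zero}          d₁₂ _ _ _ _ _ = ⊥-elim (d₁₂ refl)
three-neighbours⇒centre (suc _) {zero}  {suc _} {zero}  _ d₁₃ _ _ _ _ = ⊥-elim (d₁₃ refl)
three-neighbours⇒centre (suc _) {zero}  {suc _} {suc _} _ _ d₂₃ _ f₂ f₃ = ⊥-elim (d₂₃ (cong suc (mate-unique f₂ f₃)))
three-neighbours⇒centre (suc _) {suc _} {zero}  {zero}  _ _ d₂₃ _ _ _ = ⊥-elim (d₂₃ refl)
three-neighbours⇒centre (suc _) {suc _} {zero}  {suc _} _ d₁₃ _ f₁ _ f₃ = ⊥-elim (d₁₃ (cong suc (mate-unique f₁ f₃)))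
three-neighbours⇒centre (suc _) {suc _} {suc _}         d₁₂ _ _ f₁ f₂ _ = ⊥-elim (d₁₂ (cong suc (mate-unique f₁ f₂)))

-- For n ≥ 2 the centre has the three distinct neighbours 0, 1, 2, and
-- automorphisms preserve this, so every automorphism fixes the centre.
centre-fixed : ∀ {n} → 2 ≤ n → (σ : Permutation′ (suc (2 * n))) → IsAutomorphism (Friendship n) σ →
  σ ⟨$⟩ʳ zero ≡ zero
centre-fixed {n} 2≤n σ aut =
  three-neighbours⇒centre (σ ⟨$⟩ʳ zero) (apart 0< 1< (λ ())) (apart 0< 2< (λ ())) (apart 1< 2< (λ ()))
    (image 0<) (image 1<) (image 2<)
  where
  4≤2n : 4 ≤ 2 * n
  4≤2n = *-monoʳ-≤ 2 2≤n
  0< : 0 < 2 * n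
  0< = ≤-trans (s≤s z≤n) 4≤2n
  1< : 1 < 2 * n
  1< = ≤-trans (s≤s (s≤s z≤n)) 4≤2n
  2< : 2 < 2 * n
  2< = ≤-trans (s≤s (s≤s (s≤s z≤n))) 4≤2n
  image : ∀ {k} (k< : k < 2 * n) → Friendship n (σ ⟨$⟩ʳ zero) (σ ⟨$⟩ʳ suc (fromℕ< k<))
  image k< = Equivalence.to (aut zero (suc (fromℕ< k<))) tt
  apart : ∀ {k l} (k< : k < 2 * n) (l< : l < 2 * n) → k ≢ l →
    σ ⟨$⟩ʳ suc (fromℕ< k<) ≢ σ ⟨$⟩ʳ suc (fromℕ< l<)
  apart k< l< k≢l e = k≢l (fromℕ<-injective _ _ k< l< (suc-injective (permutation-injective σ e)))

leaf-image : ∀ {m} (σ : Permutation′ (suc m)) → σ ⟨$⟩ʳ zero ≡ zero → ∀ a → ∃ λ a′ → σ ⟨$⟩ʳ suc a ≡ suc a′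
leaf-image σ fix a with σ ⟨$⟩ʳ suc a in eq
... | zero   = ⊥-elim (0≢1+n (permutation-injective σ (trans fix (sym eq))))
... | suc a′ = a′ , refl

MatePairsDetermine : ∀ n {A : Set} → (Fin (suc (2 * n)) → A) → Set
MatePairsDetermine n φ = ∀ {a b a′ b′ : Fin (2 * n)} → Mates a b → Mates a′ b′ →
  φ (suc a) ≡ φ (suc a′) → φ (suc b) ≡ φ (suc b′) → a ≡ a′

-- A label-preserving
-- automorphism fixes the centre and maps a leaf and its mate to mates carrying
-- the same labels, hence fixes the leaf.
distinguishing-criterion : ∀ {n} {A : Set} → 2 ≤ n → (φ : Fin (suc (2 * n)) → A) →
  MatePairsDetermine n φ → IsDistinguishing (Friendship n) φ
distinguishing-criterion 2≤n φ det σ aut keeps zero = centre-fixed 2≤n σ aut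
distinguishing-criterion {n} 2≤n φ det σ aut keeps (suc a)
  with b , ab ← mate-exists {n} a
  with a′ , σa ← leaf-image σ (centre-fixed 2≤n σ aut) a
  with b′ , σb ← leaf-image σ (centre-fixed 2≤n σ aut) b
  = trans σa (cong suc (sym (det ab a′b′ (relabel σa) (relabel σb))))
  where
  a′b′ : Mates a′ b′
  a′b′ = subst₂ (Friendship n) σa σb (Equivalence.to (aut (suc a) (suc b)) ab)
  relabel : ∀ {x x′} → σ ⟨$⟩ʳ suc x ≡ suc x′ → φ (suc x) ≡ φ (suc x′)
  relabel {x} e = trans (sym (keeps (suc x))) (cong φ e)

Preserves : ∀ {m} {A : Set} → Permutation′ m → (Fin m → A) → Set
Preserves {m} σ φ = ∀ (x : Fin m) → φ (σ ⟨$⟩ʳ x) ≡ φ x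

transpose-preserves : ∀ {m} {A : Set} {i j : Fin m} (g : Fin m → A) → g i ≡ g j → Preserves (transpose i j) g
transpose-preserves {i = i} {j} g gi≡gj k with k Fin.≟ i
... | yes refl = sym gi≡gj
... | no _ with k Fin.≟ j
...   | yes refl = gi≡gj
...   | no _     = refl

∘ₚ-preserves : ∀ {m} {A : Set} {π ρ : Permutation′ m} (g : Fin m → A) → Preserves π g → Preserves ρ g → Preserves (π ∘ₚ ρ) g
∘ₚ-preserves {π = π} g pπ pρ x = trans (pρ (π ⟨$⟩ʳ x)) (pπ x)

lift₀-preserves : ∀ {m} {A : Set} {π : Permutation′ m} (φ : Fin (suc m) → A) → Preserves π (φ ∘ suc) → Preserves (lift₀ π) φ
lift₀-preserves φ p zero    = refl
lift₀-preserves φ p (suc a) = p a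

transpose-left : ∀ {m} (i j : Fin m) → transpose i j ⟨$⟩ʳ i ≡ j
transpose-left i j with i Fin.≟ i
... | yes _  = refl
... | no i≢i = ⊥-elim (i≢i refl)

transpose-right : ∀ {m} (i j : Fin m) → transpose i j ⟨$⟩ʳ j ≡ i
transpose-right i j with j Fin.≟ i
... | yes j≡i = j≡i
... | no _ with j Fin.≟ j
...   | yes _  = refl
...   | no j≢j = ⊥-elim (j≢j refl)

transpose-other : ∀ {m} {i j k : Fin m} → k ≢ i → k ≢ j → transpose i j ⟨$⟩ʳ k ≡ k
transpose-other {i = i} {j} {k} k≢i k≢j with k Fin.≟ i
... | yes k≡i = ⊥-elim (k≢i k≡i)
... | no _ with k Fin.≟ j
...   | yes k≡j = ⊥-elim (k≢j k≡j)
...   | no _    = refl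

lift₀-automorphism : ∀ {n} (π : Permutation′ (2 * n)) (f : ℕ → ℕ) → (∀ {x y} → f x ≡ f y → x ≡ y) →
  (∀ a → triangle (π ⟨$⟩ʳ a) ≡ f (triangle a)) → IsAutomorphism (Friendship n) (lift₀ π)
lift₀-automorphism π f f-inj moves zero    zero    = mk⇔ id id
lift₀-automorphism π f f-inj moves zero    (suc b) = mk⇔ id id
lift₀-automorphism π f f-inj moves (suc a) zero    = mk⇔ id id
lift₀-automorphism π f f-inj moves (suc a) (suc b) = mk⇔ forward backward
  where
  forward : Mates a b → Mates (π ⟨$⟩ʳ a) (π ⟨$⟩ʳ b)
  forward (a≢b , t) = (λ e → a≢b (permutation-injective π e)) , trans (moves a) (trans (cong f t) (sym (moves b)))
  backward : Mates (π ⟨$⟩ʳ a) (π ⟨$⟩ʳ b) → Mates a b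
  backward (πa≢πb , t) = (λ e → πa≢πb (cong (π ⟨$⟩ʳ_) e)) , f-inj (trans (sym (moves a)) (trans t (moves b)))

-- Necessary condition 1: a distinguishing labeling separates mates, since
-- otherwise swapping them is a nontrivial label-preserving automorphism.
mates-labelled-apart : ∀ {n} {A : Set} (φ : Fin (suc (2 * n)) → A) → IsDistinguishing (Friendship n) φ →
  ∀ {u w} → Mates u w → φ (suc u) ≢ φ (suc w)
mates-labelled-apart {n} φ dist {u} {w} (u≢w , t) φu≡φw =
  u≢w (sym (suc-injective (trans (sym (cong suc (transpose-left u w))) (dist σ aut keeps (suc u)))))
  where
  σ : Permutation′ (suc (2 * n))
  σ = lift₀ (transpose u w)
  aut : IsAutomorphism (Friendship n) σ
  aut = lift₀-automorphism (transpose u w) id id (transpose-preserves triangle t)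
  keeps : Preserves σ φ
  keeps = lift₀-preserves φ (transpose-preserves (φ ∘ suc) φu≡φw)

swapℕ : ℕ → ℕ → ℕ → ℕ
swapℕ t t′ x with x ≟ t
... | yes _ = t′
... | no _ with x ≟ t′
...   | yes _ = t
...   | no _  = x

swapℕ-left : ∀ t t′ → swapℕ t t′ t ≡ t′
swapℕ-left t t′ with t ≟ t
... | yes _  = refl
... | no t≢t = ⊥-elim (t≢t refl)

swapℕ-right : ∀ t t′ → swapℕ t t′ t′ ≡ t
swapℕ-right t t′ with t′ ≟ t
... | yes t′≡t = t′≡t
... | no _ with t′ ≟ t′
...   | yes _    = refl
...   | no t′≢t′ = ⊥-elim (t′≢t′ refl)

swapℕ-other : ∀ {t t′ x} → x ≢ t → x ≢ t′ → swapℕ t t′ x ≡ x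
swapℕ-other {t} {t′} {x} x≢t x≢t′ with x ≟ t
... | yes x≡t = ⊥-elim (x≢t x≡t)
... | no _ with x ≟ t′
...   | yes x≡t′ = ⊥-elim (x≢t′ x≡t′)
...   | no _     = refl

swapℕ-involutive : ∀ t t′ x → swapℕ t t′ (swapℕ t t′ x) ≡ x
swapℕ-involutive t t′ x with x ≟ t
... | yes refl = swapℕ-right x t′
... | no x≢t with x ≟ t′
...   | yes refl = swapℕ-left t x
...   | no x≢t′  = swapℕ-other x≢t x≢t′

swapℕ-injective : ∀ t t′ {x y} → swapℕ t t′ x ≡ swapℕ t t′ y → x ≡ y
swapℕ-injective t t′ {x} {y} e =
  trans (sym (swapℕ-involutive t t′ x)) (trans (cong (swapℕ t t′) e) (swapℕ-involutive t t′ y))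

-- Necessary condition 2: a distinguishing labeling gives different triangles
-- different label pairs, since otherwise exchanging the triangles
-- (u ↔ u′, w ↔ w′) is a nontrivial label-preserving automorphism.
module _ {n} {u w u′ w′ : Fin (2 * n)} (uw : Mates u w) (u′w′ : Mates u′ w′) (t≢t′ : triangle u ≢ triangle u′) where

  open ≡-Reasoning

  private
    t t′ : ℕ
    t  = triangle u
    t′ = triangle u′

    apart : ∀ {x y : Fin (2 * n)} → triangle x ≡ t → triangle y ≡ t′ → x ≢ y
    apart tx ty refl = t≢t′ (trans (sym tx) ty)

    tw : triangle w ≡ t
    tw = sym (proj₂ uw)

    tw′ : triangle w′ ≡ t′
    tw′ = sym (proj₂ u′w′)

  exchange : Permutation′ (2 * n)
  exchange = transpose u u′ ∘ₚ transpose w w′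

  private
    τ₁ τ₂ : Fin (2 * n) → Fin (2 * n)
    τ₁ = transpose u u′ ⟨$⟩ʳ_
    τ₂ = transpose w w′ ⟨$⟩ʳ_

  exchange-triangles : ∀ a → triangle (exchange ⟨$⟩ʳ a) ≡ swapℕ t t′ (triangle a)
  exchange-triangles a = by-cases (a Fin.≟ u) (a Fin.≟ u′) (a Fin.≟ w) (a Fin.≟ w′)
    where
    by-cases : Dec (a ≡ u) → Dec (a ≡ u′) → Dec (a ≡ w) → Dec (a ≡ w′) →
      triangle (τ₂ (τ₁ a)) ≡ swapℕ t t′ (triangle a)
    by-cases (yes refl) _ _ _ = begin
      triangle (τ₂ (τ₁ u))   ≡⟨ cong (triangle ∘ τ₂) (transpose-left u u′) ⟩
      triangle (τ₂ u′)       ≡⟨ cong triangle (transpose-other (≢-sym (apart tw refl)) (proj₁ u′w′)) ⟩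
      t′                     ≡⟨ sym (swapℕ-left t t′) ⟩
      swapℕ t t′ t           ∎
    by-cases (no _) (yes refl) _ _ = begin
      triangle (τ₂ (τ₁ u′))  ≡⟨ cong (triangle ∘ τ₂) (transpose-right u u′) ⟩
      triangle (τ₂ u)        ≡⟨ cong triangle (transpose-other (proj₁ uw) (apart refl tw′)) ⟩
      t                      ≡⟨ sym (swapℕ-right t t′) ⟩
      swapℕ t t′ t′          ∎
    by-cases (no w≢u) (no w≢u′) (yes refl) _ = begin
      triangle (τ₂ (τ₁ w))   ≡⟨ cong (triangle ∘ τ₂) (transpose-other w≢u w≢u′) ⟩
      triangle (τ₂ w)        ≡⟨ cong triangle (transpose-left w w′) ⟩
      triangle w′            ≡⟨ tw′ ⟩
      t′                     ≡⟨ sym (swapℕ-left t t′) ⟩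
      swapℕ t t′ t           ≡⟨ cong (swapℕ t t′) (sym tw) ⟩
      swapℕ t t′ (triangle w) ∎
    by-cases (no w′≢u) (no w′≢u′) (no _) (yes refl) = begin
      triangle (τ₂ (τ₁ w′))  ≡⟨ cong (triangle ∘ τ₂) (transpose-other w′≢u w′≢u′) ⟩
      triangle (τ₂ w′)       ≡⟨ cong triangle (transpose-right w w′) ⟩
      triangle w             ≡⟨ tw ⟩
      t                      ≡⟨ sym (swapℕ-right t t′) ⟩
      swapℕ t t′ t′          ≡⟨ cong (swapℕ t t′) (sym tw′) ⟩
      swapℕ t t′ (triangle w′) ∎
    by-cases (no a≢u) (no a≢u′) (no a≢w) (no a≢w′) = begin
      triangle (τ₂ (τ₁ a))   ≡⟨ cong (triangle ∘ τ₂) (transpose-other a≢u a≢u′) ⟩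
      triangle (τ₂ a)        ≡⟨ cong triangle (transpose-other a≢w a≢w′) ⟩
      triangle a             ≡⟨ sym (swapℕ-other (λ ta → a≢w (in-triangle-of-mates uw ta a≢u))
                                                         (λ ta → a≢w′ (in-triangle-of-mates u′w′ ta a≢u′))) ⟩
      swapℕ t t′ (triangle a) ∎

  triangles-labelled-apart : ∀ {A : Set} (φ : Fin (suc (2 * n)) → A) → IsDistinguishing (Friendship n) φ →
    φ (suc u) ≡ φ (suc u′) → φ (suc w) ≡ φ (suc w′) → ⊥
  triangles-labelled-apart φ dist φu≡φu′ φw≡φw′ = t≢t′ (begin
    t                             ≡⟨ cong triangle (sym (suc-injective (dist σ aut keeps (suc u)))) ⟩
    triangle (exchange ⟨$⟩ʳ u)    ≡⟨ exchange-triangles u ⟩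
    swapℕ t t′ t                  ≡⟨ swapℕ-left t t′ ⟩
    t′                            ∎)
    where
    σ : Permutation′ (suc (2 * n))
    σ = lift₀ exchange
    aut : IsAutomorphism (Friendship n) σ
    aut = lift₀-automorphism exchange (swapℕ t t′) (swapℕ-injective t t′) exchange-triangles
    keeps : Preserves σ φ
    keeps = lift₀-preserves φ (∘ₚ-preserves {π = transpose u u′} {ρ = transpose w w′} (φ ∘ suc)
              (transpose-preserves (φ ∘ suc) φu≡φu′) (transpose-preserves (φ ∘ suc) φw≡φw′))

-- pairs r = r(r-1)/2 is the number of 2-element subsets of an r-element set.
pairs : ℕ → ℕ
pairs zero    = 0
pairs (suc r) = pairs r + r

pairs-mono : ∀ {m k} → m ≤ k → pairs m ≤ pairs k
pairs-mono z≤n       = z≤n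
pairs-mono (s≤s m≤k) = +-mono-≤ (pairs-mono m≤k) m≤k

SamePair : ℕ × ℕ → ℕ × ℕ → Set
SamePair (x , y) (x′ , y′) = (x ≡ x′ × y ≡ y′) ⊎ (x ≡ y′ × y ≡ x′)

-- The subset {lo < hi} is ranked pairs hi + lo: the ranks of the subsets of
-- {0, …, r-1} are exactly 0, …, pairs r - 1.
rank : ℕ → ℕ → ℕ
rank lo hi = pairs hi + lo

rank-< : ∀ {lo hi r} → lo < hi → hi < r → rank lo hi < pairs r
rank-< {hi = hi} lo<hi hi<r = <-≤-trans (+-monoʳ-< (pairs hi) lo<hi) (pairs-mono hi<r)

rank-injective : ∀ {lo hi lo′ hi′} → lo < hi → lo′ < hi′ → rank lo hi ≡ rank lo′ hi′ → lo ≡ lo′ × hi ≡ hi′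
rank-injective {lo} {hi} {lo′} {hi′} lo<hi lo′<hi′ e with <-cmp hi hi′
... | tri< hi<hi′ _ _ = ⊥-elim (<⇒≢ (<-≤-trans (rank-< lo<hi hi<hi′) (m≤m+n (pairs hi′) lo′)) e)
... | tri≈ _ refl _   = +-cancelˡ-≡ (pairs hi) lo lo′ e , refl
... | tri> _ _ hi′<hi = ⊥-elim (<⇒≢ (<-≤-trans (rank-< lo′<hi′ hi′<hi) (m≤m+n (pairs hi) lo)) (sym e))

samePair-sym : ∀ {p q} → SamePair p q → SamePair q p
samePair-sym (inj₁ (x≡x′ , y≡y′)) = inj₁ (sym x≡x′ , sym y≡y′)
samePair-sym (inj₂ (x≡y′ , y≡x′)) = inj₂ (sym y≡x′ , sym x≡y′)

samePair-trans : ∀ {p q r} → SamePair p q → SamePair q r → SamePair p r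
samePair-trans (inj₁ (e₁ , e₂)) (inj₁ (f₁ , f₂)) = inj₁ (trans e₁ f₁ , trans e₂ f₂)
samePair-trans (inj₁ (e₁ , e₂)) (inj₂ (f₁ , f₂)) = inj₂ (trans e₁ f₁ , trans e₂ f₂)
samePair-trans (inj₂ (e₁ , e₂)) (inj₁ (f₁ , f₂)) = inj₂ (trans e₁ f₂ , trans e₂ f₁)
samePair-trans (inj₂ (e₁ , e₂)) (inj₂ (f₁ , f₂)) = inj₁ (trans e₁ f₂ , trans e₂ f₁)

pair-rank : ∀ {r x y} → x < r → y < r → x ≢ y → Fin (pairs r)
pair-rank {r} {x} {y} x<r y<r x≢y with <-cmp x y
... | tri< x<y _ _ = fromℕ< (rank-< x<y y<r)
... | tri≈ _ x≡y _ = ⊥-elim (x≢y x≡y)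
... | tri> _ _ y<x = fromℕ< (rank-< y<x x<r)

pair-rank-injective : ∀ {r x y x′ y′} (x<r : x < r) (y<r : y < r) (x≢y : x ≢ y)
  (x′<r : x′ < r) (y′<r : y′ < r) (x′≢y′ : x′ ≢ y′) →
  pair-rank x<r y<r x≢y ≡ pair-rank x′<r y′<r x′≢y′ → SamePair (x , y) (x′ , y′)
pair-rank-injective {x = x} {y} {x′} {y′} _ _ x≢y _ _ x′≢y′ e with <-cmp x y | <-cmp x′ y′
... | tri≈ _ x≡y _ | _            = ⊥-elim (x≢y x≡y)
... | _            | tri≈ _ x′≡y′ _ = ⊥-elim (x′≢y′ x′≡y′)
... | tri< x<y _ _ | tri< x′<y′ _ _ = inj₁ (rank-injective x<y x′<y′ (fromℕ<-injective _ _ _ _ e))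
... | tri< x<y _ _ | tri> _ _ y′<x′ = inj₂ (rank-injective x<y y′<x′ (fromℕ<-injective _ _ _ _ e))
... | tri> _ _ y<x | tri< x′<y′ _ _ = inj₂ (swap (rank-injective y<x x′<y′ (fromℕ<-injective _ _ _ _ e)))
... | tri> _ _ y<x | tri> _ _ y′<x′ = inj₁ (swap (rank-injective y<x y′<x′ (fromℕ<-injective _ _ _ _ e)))

-- Lower bound: a distinguishing labeling with r labels gives the n triangles
-- n different unordered pairs of distinct labels, so n ≤ pairs r.
distinguishable⇒≤pairs : ∀ {n r} → Distinguishable (Friendship n) r → n ≤ pairs r
distinguishable⇒≤pairs {n} {r} (φ , dist) = injective⇒≤ code-injective
  where
  label : Fin (2 * n) → ℕ
  label a = toℕ (φ (suc a))
  apart : ∀ i → label (first i) ≢ label (second i)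
  apart i e = mates-labelled-apart φ dist (first-second-mates i) (toℕ-injective e)
  bounded : ∀ a → label a < r
  bounded a = toℕ<n (φ (suc a))
  code : Fin n → Fin (pairs r)
  code i = pair-rank (bounded (first i)) (bounded (second i)) (apart i)
  pairs-differ : ∀ {i j} → i ≢ j → ¬ SamePair (label (first i) , label (second i)) (label (first j) , label (second j))
  pairs-differ {i} {j} i≢j (inj₁ (e₁ , e₂)) =
    triangles-labelled-apart (first-second-mates i) (first-second-mates j)
      (λ t → i≢j (toℕ-injective (trans (sym (triangle-first i)) (trans t (triangle-first j)))))
      φ dist (toℕ-injective e₁) (toℕ-injective e₂)
  pairs-differ {i} {j} i≢j (inj₂ (e₁ , e₂)) =
    triangles-labelled-apart (first-second-mates i) (mates-sym (first-second-mates j))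
      (λ t → i≢j (toℕ-injective (trans (sym (triangle-first i)) (trans t (triangle-second j)))))
      φ dist (toℕ-injective e₁) (toℕ-injective e₂)
  code-injective : ∀ {i j} → code i ≡ code j → i ≡ j
  code-injective {i} {j} e = decidable-stable (i Fin.≟ j) λ i≢j → pairs-differ i≢j
    (pair-rank-injective (bounded (first i)) (bounded (second i)) (apart i) (bounded (first j)) (bounded (second j)) (apart j) e)

unique-lookup-injective : ∀ {A : Set} {xs : List A} → Unique xs → ∀ {i j} → lookup xs i ≡ lookup xs j → i ≡ j
unique-lookup-injective (_  ∷ _) {zero}  {zero}  _ = refl
unique-lookup-injective (x∉ ∷ _) {zero}  {suc j} e = ⊥-elim (All.lookup x∉ (∈-lookup j) e)
unique-lookup-injective (x∉ ∷ _) {suc i} {zero}  e = ⊥-elim (All.lookup x∉ (∈-lookup i) (sym e))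
unique-lookup-injective (_  ∷ u) {suc i} {suc j} e = cong suc (unique-lookup-injective u e)

witnessed-length : ∀ {A B : Set} (R : A → B → Set) {xs : List A} {ys : List B} → Unique xs →
  (∀ {x} → x ∈ xs → ∃ λ y → y ∈ ys × R x y) →
  (∀ {x x′ y} → x ∈ xs → x′ ∈ xs → R x y → R x′ y → x ≡ x′) →
  length xs ≤ length ys
witnessed-length R {xs} {ys} uniq witness functional = injective⇒≤ f-injective
  where
  f : Fin (length xs) → Fin (length ys)
  f i = index (proj₁ (proj₂ (witness (∈-lookup i))))
  f-injective : ∀ {i j} → f i ≡ f j → i ≡ j
  f-injective {i} {j} e = unique-lookup-injective uniq
    (functional (∈-lookup i) (∈-lookup j) (proj₂ (proj₂ (witness (∈-lookup i)))) Rj)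
    where
    same-witness : proj₁ (witness (∈-lookup j)) ≡ proj₁ (witness (∈-lookup i))
    same-witness = trans (lookup-index (proj₁ (proj₂ (witness (∈-lookup j)))))
                     (trans (cong (lookup ys) (sym e)) (sym (lookup-index (proj₁ (proj₂ (witness (∈-lookup i)))))))
    Rj : R (lookup xs j) (proj₁ (witness (∈-lookup i)))
    Rj = subst (R (lookup xs j)) same-witness (proj₂ (proj₂ (witness (∈-lookup j))))

length-filter-split : ∀ {A : Set} {P : A → Set} (P? : Decidable P) (xs : List A) →
  length (filter P? xs) + length (filter (¬? ∘ P?) xs) ≡ length xs
length-filter-split P? [] = refl
length-filter-split P? (x ∷ xs) with P? x
... | yes _ = cong suc (length-filter-split P? xs)
... | no _  = trans (+-suc _ _) (cong suc (length-filter-split P? xs))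

without : ℕ → List ℕ → List ℕ
without x = filter (¬? ∘ (_≟ x))

∈-without⁻ : ∀ {x b} xs → b ∈ without x xs → b ∈ xs × b ≢ x
∈-without⁻ {x} xs = ∈-filter⁻ (¬? ∘ (_≟ x)) {xs = xs}

unique-without : ∀ x {xs} → Unique xs → Unique (without x xs)
unique-without x = filter⁺ (¬? ∘ (_≟ x))

length-without : ∀ x {xs} → Unique xs → length xs ≤ suc (length (without x xs))
length-without x {[]}     _        = z≤n
length-without x {y ∷ ys} (y∉ ∷ u) = by-cases (y ≟ x)
  where
  by-cases : Dec (y ≡ x) → length (y ∷ ys) ≤ suc (length (without x (y ∷ ys)))
  by-cases (yes refl) = s≤s (≤-reflexive (cong length (sym (begin
    without y (y ∷ ys)  ≡⟨ filter-reject (¬? ∘ (_≟ y)) (λ y≢y → y≢y refl) ⟩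
    without y ys        ≡⟨ filter-all (¬? ∘ (_≟ y)) (All.map (λ y≢z z≡y → y≢z (sym z≡y)) y∉) ⟩
    ys                  ∎))))
    where open ≡-Reasoning
  by-cases (no y≢x) = subst (λ zs → length (y ∷ ys) ≤ suc (length zs))
    (sym (filter-accept (¬? ∘ (_≟ x)) y≢x)) (s≤s (length-without x u))

samePair? : ∀ p q → Dec (SamePair p q)
samePair? (x , y) (x′ , y′) = ((x ≟ x′) ×-dec (y ≟ y′)) ⊎-dec ((x ≟ y′) ×-dec (y ≟ x′))

Involves : ℕ → ℕ × ℕ → Set
Involves x (u , v) = (u ≡ x) ⊎ (v ≡ x)

involves? : ∀ x q → Dec (Involves x q)
involves? x (u , v) = (u ≟ x) ⊎-dec (v ≟ x)

samePair-involves-first : ∀ {x b} q → SamePair (x , b) q → Involves x q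
samePair-involves-first _ (inj₁ (refl , _)) = inj₁ refl
samePair-involves-first _ (inj₂ (refl , _)) = inj₂ refl

samePair-involves : ∀ {a b x} q → SamePair (a , b) q → Involves x q → (a ≡ x) ⊎ (b ≡ x)
samePair-involves _ (inj₁ (refl , refl)) (inj₁ u≡x) = inj₁ u≡x
samePair-involves _ (inj₁ (refl , refl)) (inj₂ v≡x) = inj₂ v≡x
samePair-involves _ (inj₂ (refl , refl)) (inj₁ u≡x) = inj₂ u≡x
samePair-involves _ (inj₂ (refl , refl)) (inj₂ v≡x) = inj₁ v≡x

samePair-partner : ∀ {x b b′} q → SamePair (x , b) q → SamePair (x , b′) q → b ≢ x → b′ ≢ x → b ≡ b′
samePair-partner _ (inj₁ (_ , b≡v))   (inj₁ (_ , b′≡v))   _   _    = trans b≡v (sym b′≡v)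
samePair-partner _ (inj₁ (x≡u , _))   (inj₂ (_ , b′≡u))   _   b′≢x = ⊥-elim (b′≢x (trans b′≡u (sym x≡u)))
samePair-partner _ (inj₂ (x≡v , b≡u)) (inj₁ (x≡u , _))    b≢x _    = ⊥-elim (b≢x (trans b≡u (sym x≡u)))
samePair-partner _ (inj₂ (_ , b≡u))   (inj₂ (_ , b′≡u))   _   _    = trans b≡u (sym b′≡u)

Fresh : ℕ × ℕ → List (ℕ × ℕ) → Set
Fresh p F = ¬ Any (SamePair p) F

fresh-without : ∀ {a b x} F → a ≢ x → b ≢ x → Fresh (a , b) (filter (¬? ∘ involves? x) F) → Fresh (a , b) F
fresh-without {x = x} F a≢x b≢x fresh matches with q , q∈F , same ← find matches with involves? x q
... | yes involved = [ a≢x , b≢x ]′ (samePair-involves q same involved)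
... | no avoided   = fresh (lose (∈-filter⁺ (¬? ∘ involves? x) q∈F avoided) same)

-- Take the head x of L₁.  Either some b ∈ L₂ ∖ {x} gives a fresh pair {x, b},
-- or each of the ≥ c - 1 elements of L₂ ∖ {x} accounts for its own pair of F
-- containing x; then recurse on the tail of L₁, L₂ ∖ {x} and the pairs of F
-- avoiding x, of which there are fewer than pairs c - (c - 1) = pairs (c - 1).
fresh-pair : ∀ c {L₁ L₂ : List ℕ} (F : List (ℕ × ℕ)) → Unique L₁ → Unique L₂ →
  c ≤ length L₁ → c ≤ length L₂ → length F < pairs c →
  ∃₂ λ a b → a ∈ L₁ × b ∈ L₂ × a ≢ b × Fresh (a , b) F
fresh-pair zero    F _ _ _ _ ()
fresh-pair (suc c) {x ∷ L₁} {L₂} F (x∉L₁ ∷ u₁) u₂ (s≤s c≤L₁) c<L₂ F<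
  with any? (λ b → ¬? (any? (samePair? (x , b)) F)) (without x L₂)
... | yes fresh-for-x =
  let b , b∈ , fresh = find fresh-for-x
  in x , b , here refl , proj₁ (∈-without⁻ L₂ b∈) , (λ x≡b → proj₂ (∈-without⁻ L₂ b∈) (sym x≡b)) , fresh
... | no none-fresh = from-tail (fresh-pair c F-x u₁ (unique-without x u₂) c≤L₁ c≤B F-x<)
  where
  B : List ℕ
  B = without x L₂
  F-x : List (ℕ × ℕ)
  F-x = filter (¬? ∘ involves? x) F
  Fx : List (ℕ × ℕ)
  Fx = filter (involves? x) F
  c≤B : c ≤ length B
  c≤B = s≤s⁻¹ (≤-trans c<L₂ (length-without x u₂))
  avoids-x : ∀ {b} → b ∈ B → b ≢ x
  avoids-x b∈ = proj₂ (∈-without⁻ L₂ b∈)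
  blocked : ∀ {b} → b ∈ B → Any (SamePair (x , b)) F
  blocked b∈ = decidable-stable (any? (samePair? _) F) (λ fresh → none-fresh (lose b∈ fresh))
  B≤Fx : length B ≤ length Fx
  B≤Fx = witnessed-length (λ b q → SamePair (x , b) q) (unique-without x u₂) witness
    (λ b∈ b′∈ same same′ → samePair-partner _ same same′ (avoids-x b∈) (avoids-x b′∈))
    where
    witness : ∀ {b} → b ∈ B → ∃ λ q → q ∈ Fx × SamePair (x , b) q
    witness b∈ = let q , q∈F , same = find (blocked b∈)
                 in q , ∈-filter⁺ (involves? x) q∈F (samePair-involves-first q same) , same
  F-x< : length F-x < pairs c
  F-x< = +-cancelʳ-< c (length F-x) (pairs c) (begin-strict
    length F-x + c            ≤⟨ +-monoʳ-≤ (length F-x) (≤-trans c≤B B≤Fx) ⟩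
    length F-x + length Fx    ≡⟨ +-comm (length F-x) (length Fx) ⟩
    length Fx + length F-x    ≡⟨ length-filter-split (involves? x) F ⟩
    length F                  <⟨ F< ⟩
    pairs c + c               ∎)
    where open ≤-Reasoning
  from-tail : (∃₂ λ a b → a ∈ L₁ × b ∈ B × a ≢ b × Fresh (a , b) F-x) →
    ∃₂ λ a b → a ∈ x ∷ L₁ × b ∈ L₂ × a ≢ b × Fresh (a , b) F
  from-tail (a , b , a∈ , b∈ , a≢b , fresh) = a , b , there a∈ , proj₁ (∈-without⁻ L₂ b∈) , a≢b ,
    fresh-without F (λ a≡x → All.lookup x∉L₁ a∈ (sym a≡x)) (avoids-x b∈) fresh

component : ℕ → ℕ × ℕ → ℕ
component zero    = proj₁
component (suc _) = proj₂

components-differ : ∀ {s s′} (p : ℕ × ℕ) → s < 2 → s′ < 2 → s ≢ s′ → SamePair (component s p , component s′ p) p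
components-differ p (s≤s z≤n)       (s≤s z≤n)       d = ⊥-elim (d refl)
components-differ p (s≤s z≤n)       (s≤s (s≤s z≤n)) _ = inj₁ (refl , refl)
components-differ p (s≤s (s≤s z≤n)) (s≤s z≤n)       _ = inj₂ (refl , refl)
components-differ p (s≤s (s≤s z≤n)) (s≤s (s≤s z≤n)) d = ⊥-elim (d refl)

samePair-apart : ∀ {x y} p → SamePair (x , y) p → proj₁ p ≢ proj₂ p → x ≢ y
samePair-apart _ (inj₁ (refl , refl)) p₁≢p₂ x≡y = p₁≢p₂ x≡y
samePair-apart _ (inj₂ (refl , refl)) p₁≢p₂ x≡y = p₁≢p₂ (sym x≡y)

extend : (ℕ → ℕ × ℕ) → ℕ → ℕ × ℕ → ℕ → ℕ × ℕ
extend g m p t with t ≟ m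
... | yes _ = p
... | no _  = g t

extend-new : ∀ g m p → extend g m p m ≡ p
extend-new g m p with m ≟ m
... | yes _  = refl
... | no m≢m = ⊥-elim (m≢m refl)

extend-old : ∀ g {m} p {t} → t ≢ m → extend g m p t ≡ g t
extend-old g {m} p {t} t≢m with t ≟ m
... | yes t≡m = ⊥-elim (t≢m t≡m)
... | no _    = refl

pairs-positive : ∀ {c} → 1 ≤ pairs c → 1 ≤ c
pairs-positive {zero}  ()
pairs-positive {suc _} _ = s≤s z≤n

module Greedy {n c} (L : Fin (suc (2 * n)) → List ℕ) (uniq : ∀ v → Unique (L v)) (len : ∀ v → length (L v) ≡ c)
  (2≤n : 2 ≤ n) (n≤pairs : n ≤ pairs c) where

  -- g : ℕ → ℕ × ℕ assigns label pairs to the triangles below m: leaf a gets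
  -- component (side a) of the pair of its triangle, taken from its list; the
  -- pairs consist of distinct labels and are pairwise different.
  record Valid (m : ℕ) (g : ℕ → ℕ × ℕ) : Set where
    field
      allowed  : ∀ a → triangle a < m → component (side a) (g (triangle a)) ∈ L (suc a)
      proper   : ∀ t → t < m → proj₁ (g t) ≢ proj₂ (g t)
      distinct : ∀ {t t′} → t < m → t′ < m → SamePair (g t) (g t′) → t ≡ t′

  triangle-allowed : ∀ (i : Fin n) {a b} → a ∈ L (suc (first i)) → b ∈ L (suc (second i)) →
    ∀ x → triangle x ≡ toℕ i → component (side x) (a , b) ∈ L (suc x)
  triangle-allowed i {a} {b} a∈ b∈ x tx with x Fin.≟ first i
  ... | yes refl = subst (λ s → component s (a , b) ∈ L (suc (first i))) (sym (side-first i)) a∈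
  ... | no x≢first = subst (λ y → component (side y) (a , b) ∈ L (suc y))
          (sym (in-triangle-of-mates (first-second-mates i) (trans tx (sym (triangle-first i))) x≢first))
          (subst (λ s → component s (a , b) ∈ L (suc (second i))) (sym (side-second i)) b∈)

  extend-valid : ∀ {m g} (m<n : m < n) → Valid m g → ∀ a b →
    a ∈ L (suc (first (fromℕ< m<n))) → b ∈ L (suc (second (fromℕ< m<n))) → a ≢ b →
    Fresh (a , b) (map g (upTo m)) → Valid (suc m) (extend g m (a , b))
  extend-valid {m} {g} m<n v a b a∈ b∈ a≢b fresh = record
    { allowed = allowed ; proper = proper ; distinct = distinct }
    where
    module V = Valid v
    i : Fin n
    i = fromℕ< m<n
    g′ : ℕ → ℕ × ℕ
    g′ = extend g m (a , b)
    at-m : ∀ {t} → t ≡ m → g′ t ≡ (a , b)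
    at-m refl = extend-new g m (a , b)
    below-m : ∀ {t} → t < m → g′ t ≡ g t
    below-m t<m = extend-old g (a , b) (<⇒≢ t<m)
    fresh-below : ∀ {t} → t < m → ¬ SamePair (a , b) (g t)
    fresh-below t<m same = fresh (lose (∈-map⁺ g (∈-upTo⁺ t<m)) same)
    allowed : ∀ x → triangle x < suc m → component (side x) (g′ (triangle x)) ∈ L (suc x)
    allowed x tx<1+m with m<1+n⇒m<n∨m≡n tx<1+m
    ... | inj₁ tx<m = subst (λ p → component (side x) p ∈ L (suc x)) (sym (below-m tx<m)) (V.allowed x tx<m)
    ... | inj₂ tx≡m = subst (λ p → component (side x) p ∈ L (suc x)) (sym (at-m tx≡m))
                        (triangle-allowed i a∈ b∈ x (trans tx≡m (sym (toℕ-fromℕ< m<n))))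
    proper : ∀ t → t < suc m → proj₁ (g′ t) ≢ proj₂ (g′ t)
    proper t t<1+m with m<1+n⇒m<n∨m≡n t<1+m
    ... | inj₁ t<m = subst (λ p → proj₁ p ≢ proj₂ p) (sym (below-m t<m)) (V.proper t t<m)
    ... | inj₂ t≡m = subst (λ p → proj₁ p ≢ proj₂ p) (sym (at-m t≡m)) a≢b
    distinct : ∀ {t t′} → t < suc m → t′ < suc m → SamePair (g′ t) (g′ t′) → t ≡ t′
    distinct t<1+m t′<1+m same with m<1+n⇒m<n∨m≡n t<1+m | m<1+n⇒m<n∨m≡n t′<1+m
    ... | inj₂ t≡m  | inj₂ t′≡m = trans t≡m (sym t′≡m)
    ... | inj₂ t≡m  | inj₁ t′<m = ⊥-elim (fresh-below t′<m (subst₂ SamePair (at-m t≡m) (below-m t′<m) same))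
    ... | inj₁ t<m  | inj₂ t′≡m = ⊥-elim (fresh-below t<m (subst₂ SamePair (at-m t′≡m) (below-m t<m) (samePair-sym same)))
    ... | inj₁ t<m  | inj₁ t′<m = V.distinct t<m t′<m (subst₂ SamePair (below-m t<m) (below-m t′<m) same)

  build : ∀ m → m ≤ n → Σ (ℕ → ℕ × ℕ) (Valid m)
  build zero _ = (λ _ → 0 , 0) , record { allowed = λ _ () ; proper = λ _ () ; distinct = λ () }
  build (suc m) m<n with g , v ← build m (<⇒≤ m<n)
    with a , b , a∈ , b∈ , a≢b , fresh ←
      fresh-pair c (map g (upTo m)) (uniq _) (uniq _) (≤-reflexive (sym (len _))) (≤-reflexive (sym (len _)))
        (subst (_< pairs c) (sym (trans (length-map g (upTo m)) (length-upTo m))) (<-≤-trans m<n n≤pairs))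
    = extend g m (a , b) , extend-valid m<n v a b a∈ b∈ a≢b fresh

  chosen : ℕ → ℕ × ℕ
  chosen = proj₁ (build n ≤-refl)

  module C = Valid (proj₂ (build n ≤-refl))

  -- The centre gets any element of its list, which is nonempty since c ≥ 1.
  centre-choice : ∃ λ x → x ∈ L zero
  centre-choice with L zero | subst (1 ≤_) (sym (len zero)) (pairs-positive (≤-trans (s≤s z≤n) (≤-trans 2≤n n≤pairs)))
  ... | x ∷ _ | _ = x , here refl

  φ : Fin (suc (2 * n)) → ℕ
  φ zero    = proj₁ centre-choice
  φ (suc a) = component (side a) (chosen (triangle a))

  φ-allowed : ∀ v → φ v ∈ L v
  φ-allowed zero    = proj₂ centre-choice
  φ-allowed (suc a) = C.allowed a (triangle<n a)

  mates-labels : ∀ {a b} → Mates a b → SamePair (φ (suc a) , φ (suc b)) (chosen (triangle a))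
  mates-labels {a} {b} ab = subst (λ t → SamePair (φ (suc a) , component (side b) (chosen t)) (chosen (triangle a)))
    (proj₂ ab) (components-differ (chosen (triangle a)) (side<2 a) (side<2 b) (mates-sides-differ ab))

  mates-apart : ∀ {a b} → Mates a b → φ (suc a) ≢ φ (suc b)
  mates-apart {a} ab = samePair-apart (chosen (triangle a)) (mates-labels ab) (C.proper (triangle a) (triangle<n a))

  φ-determines : MatePairsDetermine n φ
  φ-determines {a} {b} {a′} {b′} ab a′b′ e e′ = decidable-stable (a Fin.≟ a′) λ a≢a′ →
    mates-apart (a≢a′ , same-triangle) e
    where
    same-triangle : triangle a ≡ triangle a′
    same-triangle = C.distinct (triangle<n a) (triangle<n a′)
      (samePair-trans (samePair-sym (mates-labels ab))
        (subst (λ p → SamePair p (chosen (triangle a′))) (sym (cong₂ _,_ e e′)) (mates-labels a′b′)))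

≤pairs⇒list-distinguishable : ∀ {n c} → 2 ≤ n → n ≤ pairs c → ListDistinguishable (Friendship n) c
≤pairs⇒list-distinguishable {n} 2≤n n≤pairs L uniq len =
  G.φ , G.φ-allowed , distinguishing-criterion 2≤n G.φ G.φ-determines
  where
  module G = Greedy L uniq len 2≤n n≤pairs

double-pairs : ∀ c → 2 * pairs (suc c) ≡ c * suc c
double-pairs zero    = refl
double-pairs (suc c) = begin
  2 * (pairs (suc c) + suc c)     ≡⟨ *-distribˡ-+ 2 (pairs (suc c)) (suc c) ⟩
  2 * pairs (suc c) + 2 * suc c   ≡⟨ cong (_+ 2 * suc c) (double-pairs c) ⟩
  c * suc c + 2 * suc c           ≡⟨ sym (*-distribʳ-+ (suc c) c 2) ⟩
  (c + 2) * suc c                 ≡⟨ cong (_* suc c) (+-comm c 2) ⟩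
  suc (suc c) * suc c             ≡⟨ *-comm (suc (suc c)) (suc c) ⟩
  suc c * suc (suc c)             ∎
  where open ≡-Reasoning

square-identity : ∀ c → (1 + 2 * c) * (1 + 2 * c) ≡ 4 * (c * (1 + c)) + 1
square-identity = solve-∀

odd-square : ∀ c → (2 * suc c ∸ 1) ^ 2 ≡ 8 * pairs (suc c) + 1
odd-square c = begin
  (2 * suc c ∸ 1) ^ 2        ≡⟨ cong (λ x → (x ∸ 1) ^ 2) (*-suc 2 c) ⟩
  suc (2 * c) ^ 2            ≡⟨ cong (suc (2 * c) *_) (*-identityʳ (suc (2 * c))) ⟩
  suc (2 * c) * suc (2 * c)  ≡⟨ square-identity c ⟩
  4 * (c * suc c) + 1        ≡⟨ cong (λ x → 4 * x + 1) (sym (double-pairs c)) ⟩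
  4 * (2 * pairs (suc c)) + 1 ≡⟨ cong (_+ 1) (sym (*-assoc 4 2 (pairs (suc c)))) ⟩
  8 * pairs (suc c) + 1      ∎
  where open ≡-Reasoning

ceil⇒≤pairs : ∀ {n c} → CeilCond n c → n ≤ pairs c
ceil⇒≤pairs {c = zero}  (() , _)
ceil⇒≤pairs {n} {suc c} (_ , ≤square) =
  *-cancelˡ-≤ 8 (+-cancelʳ-≤ 1 (8 * n) (8 * pairs (suc c)) (subst (8 * n + 1 ≤_) (odd-square c) ≤square))

≤pairs⇒ceil : ∀ {n c} → 2 ≤ n → n ≤ pairs c → CeilCond n c
≤pairs⇒ceil {c = zero}  (s≤s _) ()
≤pairs⇒ceil {n} {suc c} _ n≤pairs =
  s≤s z≤n , subst (8 * n + 1 ≤_) (sym (odd-square c)) (+-monoˡ-≤ 1 (*-monoʳ-≤ 8 n≤pairs))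

-- D ≤ D_l: giving every vertex the list 0, …, k - 1 turns a list labeling into
-- a labeling with k labels.
list⇒distinguishable : ∀ {N} (G : Graph N) k → ListDistinguishable G k → Distinguishable G k
list⇒distinguishable {N} G k list with φ , φ∈ , dist ← list (λ _ → upTo k) (λ _ → upTo⁺ k) (λ _ → length-upTo k)
  = ψ , λ σ aut keeps → dist σ aut (λ x → begin
      φ (σ ⟨$⟩ʳ x)          ≡⟨ sym (toℕ-fromℕ< (∈-upTo⁻ (φ∈ (σ ⟨$⟩ʳ x)))) ⟩
      toℕ (ψ (σ ⟨$⟩ʳ x))    ≡⟨ cong toℕ (keeps x) ⟩
      toℕ (ψ x)             ≡⟨ toℕ-fromℕ< (∈-upTo⁻ (φ∈ x)) ⟩
      φ x                   ∎)
  where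
  open ≡-Reasoning
  ψ : Fin N → Fin k
  ψ v = fromℕ< (∈-upTo⁻ (φ∈ v))

-- c lies above D_l(F_n) by the greedy upper bound, and below every number of
-- labels admitting a distinguishing (list) labeling, since such a number
-- satisfies the ceiling condition by the lower bound and c is least with it.
mainTheorem1 : ∀ (n : ℕ) → 2 ≤ n → ∀ (c : ℕ) → IsCeilFormula n c →
    ListDistNumberIs (Friendship n) c × DistNumberIs (Friendship n) c
mainTheorem1 n 2≤n c (ceil , least) =
  (upper , λ k list → minimal k (list⇒distinguishable (Friendship n) k list)) ,
  (list⇒distinguishable (Friendship n) c upper , minimal)
  where
  upper : ListDistinguishable (Friendship n) c
  upper = ≤pairs⇒list-distinguishable 2≤n (ceil⇒≤pairs ceil)
  minimal : ∀ r → Distinguishable (Friendship n) r → c ≤ r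
  minimal r d = least r (≤pairs⇒ceil 2≤n (distinguishable⇒≤pairs d))
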